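{- Let $G$ be a finite simple graph and $P$ a singleton-friendly frame property of colorings on $G$. Suppose $C$ is a $P$-optimal coloring of $G$, $\{a\},\{b\}\in C$ are two distinct singleton color classes, and $p_a$, $p_b$ are vertex-disjoint directed paths in $L_C(G)$, with $p_a$ starting at $a$ and $p_b$ starting at $b$, such that each of $p_a$, $p_b$ contains at most one vertex from any given color class of $C$. Then every vertex of $p_a$ is adjacent in $G$ to every vertex of $p_b$.
   Context: A (proper) coloring of $G$ is a partition of $V(G)$ into independent sets (color classes). The frame $\mathrm{Frame}(C)$ of a coloring $C$ is the nondecreasing sequence of the sizes of its color classes. A property of colorings on $G$ is any subset $P$ of the set of proper colorings of $G$. $P$ is a frame property if whenever $\mathrm{Frame}(C)=\mathrm{Frame}(C')$ and $C\in P$, then $C'\in P$. $P$ is singleton-friendly if whenever $C\in P$ and $C'$ is obtained from $C$ by merging two singleton color classes of $C$ into one class, then $C'\in P$. A coloring $C$ is $P$-optimal if $C\in P$ and $|C|$ (its number of color classes) is minimal among colorings of $G$ in $P$. A directed pair $(v,w)$ is $C$-lonely if there are distinct color classes $I_j\ne I_k$ of $C$ with $v\in I_j$, $w\in I_k$ and $N(v)\cap I_k=\{w\}$; $L_C(G)$ is the directed graph on $V(G)$ whose edges are the $C$-lonely pairs. -}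

module Defs where

open import Data.Nat using (ℕ; _≤_; _+_)
open import Data.Nat.Properties using (≤-decTotalOrder)
open import Data.Fin using (Fin)
open import Data.Fin.Properties using (_≟_)
open import Data.List using (List; []; _∷_; map; length; filter; allFin)
open import Data.List.Membership.Propositional using (_∈_)
open import Data.List.Relation.Unary.Linked using (Linked)
open import Data.List.Relation.Unary.Unique.Propositional using (Unique)
open import Data.Product using (Σ; ∃; _×_)
open import Data.Sum using (_⊎_)
open import Relation.Binary.PropositionalEquality using (_≡_; _≢_)
open import Relation.Nullary using (Dec; ¬_)
open import Function.Bundles using (_⇔_)
import Data.List.Sort as Sort

record Graph : Set₁ where
  field
    n      : ℕ
    Adj    : Fin n → Fin n → Set
    sym    : ∀ {u v} → Adj u v → Adj v u
    irrefl : ∀ {v} → ¬ Adj v v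
    dec    : ∀ u v → Dec (Adj u v)

module _ (G : Graph) where
  open Graph G

  V : Set
  V = Fin n

  -- A proper coloring: a partition of V into k nonempty independent
  -- classes, presented by a class-assignment map col : V → Fin k
  -- (class i is the fiber col⁻¹(i); surjectivity = classes nonempty).
  record Coloring : Set where
    field
      k      : ℕ
      col    : V → Fin k
      surj   : ∀ i → ∃ λ v → col v ≡ i
      proper : ∀ u v → Adj u v → col u ≢ col v
  open Coloring public

  ∣_∣ᶜ : Coloring → ℕ
  ∣ C ∣ᶜ = k C

  classSize : (C : Coloring) → Fin (k C) → ℕ
  classSize C i = length (filter (λ v → col C v ≟ i) (allFin n))

  open Sort ≤-decTotalOrder using (sort)

  Frame : Coloring → List ℕ
  Frame C = sort (map (classSize C) (allFin (k C)))

  Property : Set₁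
  Property = Coloring → Set

  IsFrameProperty : Property → Set
  IsFrameProperty P = ∀ C C' → Frame C ≡ Frame C' → P C → P C'

  IsSingletonClass : (C : Coloring) → Fin (k C) → V → Set
  IsSingletonClass C i v = ∀ u → (col C u ≡ i) ⇔ (u ≡ v)

  MergeOf : (C : Coloring) → Fin (k C) → Fin (k C) → Coloring → Set
  MergeOf C i j C' = ∀ u v →
    (col C' u ≡ col C' v) ⇔
      (col C u ≡ col C v ⊎ (col C u ≡ i × col C v ≡ j) ⊎ (col C u ≡ j × col C v ≡ i))

  IsSingletonFriendly : Property → Set
  IsSingletonFriendly P = ∀ C (i j : Fin (k C)) (x y : V) → i ≢ j →
    IsSingletonClass C i x → IsSingletonClass C j y →
    ∀ C' → MergeOf C i j C' → P C → P C'

  IsOptimal : Property → Coloring → Set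
  IsOptimal P C = P C × (∀ C' → P C' → ∣ C ∣ᶜ ≤ ∣ C' ∣ᶜ)

  Lonely : Coloring → V → V → Set
  Lonely C v w = col C v ≢ col C w × (∀ u → (Adj v u × col C u ≡ col C w) ⇔ (u ≡ w))

  -- a directed path in L_C(G), given by its (distinct) vertex list
  IsDirPath : Coloring → List V → Set
  IsDirPath C p = Linked (Lonely C) p × Unique p

-- Induct on the total length of the two paths, showing that their last vertices are adjacent
-- (arbitrary x and y are then handled by the prefixes ending there).  For trivial paths, two
-- nonadjacent singleton classes {a}, {b} could be merged into a coloring in P with fewer
-- classes.  Otherwise let v follow a on its path: exchanging the colors of a and v is again
-- a proper coloring, with the same frame, in which {v} is a singleton class and the remaining
-- paths are still lonely, provided no vertex on b's path has v's color; this last fact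
-- follows from the induction hypothesis applied to prefixes of the paths.
module Submission where

open import Defs
open import Data.Empty using (⊥; ⊥-elim)
open import Data.Fin using (Fin; zero; suc; punchOut; punchIn)
open import Data.Fin.Permutation as Perm using (Permutation′; _⟨$⟩ʳ_)
open import Data.Fin.Properties using (_≟_; punchOut-cong; punchOut-injective; punchOut-punchIn; punchInᵢ≢i)
open import Data.List using (List; []; _∷_; _++_; map; length; filter; tabulate; allFin)
open import Data.List.Membership.Propositional using (_∈_)
open import Data.List.Membership.Propositional.Properties using (∈-++⁺ˡ; ∈-++⁺ʳ; ∈-∃++)
open import Data.List.Properties using (length-++; map-++; map-cong)
open import Data.List.Relation.Unary.All as All using (All; []; _∷_)
import Data.List.Relation.Unary.All.Properties as All
open import Data.List.Relation.Unary.AllPairs using ([]; _∷_)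
open import Data.List.Relation.Unary.Any using (here; there)
open import Data.List.Relation.Unary.Linked as Linked using (Linked; []; [-]; _∷_)
open import Data.List.Relation.Unary.Unique.Propositional as Unique using (Unique)
open import Data.Nat using (ℕ; zero; suc; _+_; _≤_; s≤s; z≤n)
open import Data.Nat.Properties using (+-0-commutativeMonoid; ≤-decTotalOrder; ≤-refl; ≤-trans; m≤n+m; m<m+n; 1+n≰n; +-identityʳ)
open import Data.Product using (Σ; ∃; ∃₂; _×_; _,_; proj₁; proj₂)
open import Data.Sum using (_⊎_; inj₁; inj₂)
open import Function using (_∘_; _⇔_; mk⇔; Equivalence)
open import Relation.Binary.PropositionalEquality using (_≡_; _≢_; ≢-sym; refl; sym; trans; cong; cong₂; subst; subst₂; module ≡-Reasoning)
open import Relation.Nullary using (Dec; yes; no; ¬_)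
open import Relation.Unary using (Pred; Decidable)
open import Algebra.Properties.CommutativeMonoid.Sum +-0-commutativeMonoid using (sum; sum-permute)
import Data.List.Sort as Sort

open Equivalence using (to; from)

module _ {A : Set} where

  last : A → List A → A
  last x []       = x
  last _ (y ∷ ys) = last y ys

  ∈⇒prefix-ending-at : ∀ {x y} ys → y ∈ x ∷ ys → ∃₂ λ zs ws → ys ≡ zs ++ ws × last x zs ≡ y
  ∈⇒prefix-ending-at ys       (here refl) = [] , ys , refl , refl
  ∈⇒prefix-ending-at (y ∷ ys) (there y∈) with ∈⇒prefix-ending-at ys y∈
  ... | zs , ws , refl , eq = y ∷ zs , ws , refl , eq

  Linked-last : ∀ {R : A → A → Set} x ys {w zs} → Linked R (x ∷ ys ++ w ∷ zs) → R (last x ys) w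
  Linked-last x []       (r ∷ _) = r
  Linked-last x (y ∷ ys) (_ ∷ l) = Linked-last y ys l

  Linked-++⁻ˡ : ∀ {R : A → A → Set} xs {ys} → Linked R (xs ++ ys) → Linked R xs
  Linked-++⁻ˡ []           _       = []
  Linked-++⁻ˡ (x ∷ [])     _       = [-]
  Linked-++⁻ˡ (x ∷ y ∷ xs) (r ∷ l) = r ∷ Linked-++⁻ˡ (y ∷ xs) l

  Unique-++⁻ˡ : ∀ (xs : List A) {ys} → Unique (xs ++ ys) → Unique xs
  Unique-++⁻ˡ []       _       = []
  Unique-++⁻ˡ (x ∷ xs) (h ∷ u) = All.++⁻ˡ xs h ∷ Unique-++⁻ˡ xs u

  map-cong-All : ∀ {B : Set} {f g : A → B} {xs} → All (λ x → f x ≡ g x) xs → map f xs ≡ map g xs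
  map-cong-All []       = refl
  map-cong-All (e ∷ es) = cong₂ _∷_ e (map-cong-All es)

indicator : ∀ {Q : Set} → Dec Q → ℕ
indicator (yes _) = 1
indicator (no _)  = 0

length-filter-tabulate : ∀ {A : Set} {m} {Q : Pred A _} (Q? : Decidable Q) (f : Fin m → A) →
  length (filter Q? (tabulate f)) ≡ sum (λ i → indicator (Q? (f i)))
length-filter-tabulate {m = zero}  Q? f = refl
length-filter-tabulate {m = suc m} Q? f with Q? (f zero)
... | yes _ = cong suc (length-filter-tabulate Q? (f ∘ suc))
... | no _  = length-filter-tabulate Q? (f ∘ suc)

count-permute : ∀ {m} {Q : Pred (Fin m) _} (Q? : Decidable Q) (π : Permutation′ m) →
  length (filter Q? (allFin m)) ≡ length (filter (λ i → Q? (π ⟨$⟩ʳ i)) (allFin m))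
count-permute Q? π = begin
  length (filter Q? (allFin _))                     ≡⟨ length-filter-tabulate Q? (λ i → i) ⟩
  sum (λ i → indicator (Q? i))                      ≡⟨ sum-permute (λ i → indicator (Q? i)) π ⟩
  sum (λ i → indicator (Q? (π ⟨$⟩ʳ i)))             ≡⟨ length-filter-tabulate (λ i → Q? (π ⟨$⟩ʳ i)) (λ i → i) ⟨
  length (filter (λ i → Q? (π ⟨$⟩ʳ i)) (allFin _))  ∎
  where open ≡-Reasoning

module Fuse {n} {i j : Fin (suc n)} (i≢j : i ≢ j) where

  Identified : Fin (suc n) → Fin (suc n) → Set
  Identified c d = c ≡ d ⊎ (c ≡ i × d ≡ j) ⊎ (c ≡ j × d ≡ i)

  redirect : Fin (suc n) → Fin (suc n)
  redirect c with c ≟ j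
  ... | yes _ = i
  ... | no _  = c

  j≢redirect : ∀ c → j ≢ redirect c
  j≢redirect c with c ≟ j
  ... | yes _   = ≢-sym i≢j
  ... | no c≢j  = ≢-sym c≢j

  redirect-j : redirect j ≡ i
  redirect-j with j ≟ j
  ... | yes _   = refl
  ... | no j≢j  = ⊥-elim (j≢j refl)

  redirect-i : redirect i ≡ i
  redirect-i with i ≟ j
  ... | yes _ = refl
  ... | no _  = refl

  redirect-≢j : ∀ c → c ≢ j → redirect c ≡ c
  redirect-≢j c c≢j with c ≟ j
  ... | yes c≡j = ⊥-elim (c≢j c≡j)
  ... | no _    = refl

  redirect-identifies : ∀ c d → redirect c ≡ redirect d ⇔ Identified c d
  redirect-identifies c d = mk⇔ forward backward
    where
      forward : redirect c ≡ redirect d → Identified c d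
      forward e with c ≟ j | d ≟ j
      ... | yes c≡j | yes d≡j = inj₁ (trans c≡j (sym d≡j))
      ... | yes c≡j | no _    = inj₂ (inj₂ (c≡j , sym e))
      ... | no _    | yes d≡j = inj₂ (inj₁ (e , d≡j))
      ... | no _    | no _    = inj₁ e
      backward : Identified c d → redirect c ≡ redirect d
      backward (inj₁ refl)                = refl
      backward (inj₂ (inj₁ (refl , refl))) = trans redirect-i (sym redirect-j)
      backward (inj₂ (inj₂ (refl , refl))) = trans redirect-j (sym redirect-i)

  fuse : Fin (suc n) → Fin n
  fuse c = punchOut (j≢redirect c)

  fuse-identifies : ∀ c d → fuse c ≡ fuse d ⇔ Identified c d
  fuse-identifies c d = mk⇔
    (to (redirect-identifies c d) ∘ punchOut-injective (j≢redirect c) (j≢redirect d))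
    (punchOut-cong j ∘ from (redirect-identifies c d))

  fuse-punchIn : ∀ x → fuse (punchIn j x) ≡ x
  fuse-punchIn x = trans (punchOut-cong j (redirect-≢j (punchIn j x) (punchInᵢ≢i j x))) (punchOut-punchIn j)

module _ (G : Graph) where
  open Graph G using (Adj; irrefl) renaming (sym to Adj-sym)

  mergeClasses : (C : Coloring G) (i j : Fin (k C)) → i ≢ j →
    (∀ u v → col C u ≡ i → col C v ≡ j → ¬ Adj u v) →
    Σ (Coloring G) λ C' → suc (k C') ≡ k C × MergeOf G C i j C'
  mergeClasses record { k = suc m ; col = c ; surj = s ; proper = pr } i j i≢j no-edge =
    merged , refl , λ u v → fuse-identifies (c u) (c v)
    where
      open Fuse i≢j

      merged-surj : ∀ x → ∃ λ v → fuse (c v) ≡ x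
      merged-surj x with s (punchIn j x)
      ... | v , e = v , trans (cong fuse e) (fuse-punchIn x)

      merged-proper : ∀ u v → Adj u v → fuse (c u) ≢ fuse (c v)
      merged-proper u v a e with to (fuse-identifies (c u) (c v)) e
      ... | inj₁ same              = pr u v a same
      ... | inj₂ (inj₁ (ui , vj)) = no-edge u v ui vj a
      ... | inj₂ (inj₂ (uj , vi)) = no-edge v u vi uj (Adj-sym a)

      merged : Coloring G
      merged = record { k = m ; col = fuse ∘ c ; surj = merged-surj ; proper = merged-proper }

  mergeSingletons : ∀ (C : Coloring G) {a b} → col C a ≢ col C b →
    IsSingletonClass G C (col C a) a → IsSingletonClass G C (col C b) b → ¬ Adj a b →
    Σ (Coloring G) λ C' → suc (k C') ≡ k C × MergeOf G C (col C a) (col C b) C'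
  mergeSingletons C {a} {b} ca≢cb a-singleton b-singleton ¬a~b = mergeClasses C (col C a) (col C b) ca≢cb
    λ u v ua vb → ¬a~b ∘ subst₂ Adj (to (a-singleton u) ua) (to (b-singleton v) vb)

  -- Exchanging the colors of p and q stays proper because p has no neighbour in q's class
  -- other than q, and p's class contains nothing but p.
  module Swap (C : Coloring G) {p q : V G}
              (p-singleton : IsSingletonClass G C (col C p) p) (pq-lonely : Lonely G C p q) where

    τ : Permutation′ (Graph.n G)
    τ = Perm.transpose p q

    swap-col : V G → Fin (k C)
    swap-col u = col C (τ ⟨$⟩ʳ u)

    cp≢cq : col C p ≢ col C q
    cp≢cq = proj₁ pq-lonely

    p≢q : p ≢ q
    p≢q = cp≢cq ∘ cong (col C)

    data Role (u : V G) : Set where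
      is-p      : u ≡ p → Role u
      is-q      : u ≡ q → Role u
      elsewhere : u ≢ p → u ≢ q → Role u

    role : ∀ u → Role u
    role u with u ≟ p | u ≟ q
    ... | yes u≡p | _       = is-p u≡p
    ... | no _    | yes u≡q = is-q u≡q
    ... | no u≢p  | no u≢q  = elsewhere u≢p u≢q

    swap-col-p : swap-col p ≡ col C q
    swap-col-p with p ≟ p
    ... | yes _   = refl
    ... | no p≢p  = ⊥-elim (p≢p refl)

    swap-col-q : swap-col q ≡ col C p
    swap-col-q with q ≟ p
    ... | yes q≡p = ⊥-elim (p≢q (sym q≡p))
    ... | no _ with q ≟ q
    ...   | yes _   = refl
    ...   | no q≢q  = ⊥-elim (q≢q refl)

    swap-col-elsewhere : ∀ {u} → u ≢ p → u ≢ q → swap-col u ≡ col C u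
    swap-col-elsewhere {u} u≢p u≢q with u ≟ p
    ... | yes u≡p = ⊥-elim (u≢p u≡p)
    ... | no _ with u ≟ q
    ...   | yes u≡q = ⊥-elim (u≢q u≡q)
    ...   | no _    = refl

    swap-col-p≢elsewhere : ∀ {w} → Adj p w → w ≢ p → w ≢ q → swap-col p ≢ swap-col w
    swap-col-p≢elsewhere {w} a w≢p w≢q e =
      w≢q (to (proj₂ pq-lonely w) (a , trans (sym (swap-col-elsewhere w≢p w≢q)) (trans (sym e) swap-col-p)))

    swap-col-q≢elsewhere : ∀ {w} → w ≢ p → w ≢ q → swap-col q ≢ swap-col w
    swap-col-q≢elsewhere {w} w≢p w≢q e =
      w≢p (to (p-singleton w) (trans (sym (swap-col-elsewhere w≢p w≢q)) (trans (sym e) swap-col-q)))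

    swap-proper : ∀ u w → Adj u w → swap-col u ≢ swap-col w
    swap-proper u w a e with role u | role w
    ... | is-p refl       | is-p refl       = irrefl a
    ... | is-q refl       | is-q refl       = irrefl a
    ... | is-p refl       | is-q refl       = cp≢cq (trans (sym swap-col-q) (trans (sym e) swap-col-p))
    ... | is-q refl       | is-p refl       = cp≢cq (trans (sym swap-col-q) (trans e swap-col-p))
    ... | is-p refl       | elsewhere w≢p w≢q = swap-col-p≢elsewhere a w≢p w≢q e
    ... | elsewhere u≢p u≢q | is-p refl     = swap-col-p≢elsewhere (Adj-sym a) u≢p u≢q (sym e)
    ... | is-q refl       | elsewhere w≢p w≢q = swap-col-q≢elsewhere w≢p w≢q e
    ... | elsewhere u≢p u≢q | is-q refl     = swap-col-q≢elsewhere u≢p u≢q (sym e)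
    ... | elsewhere u≢p u≢q | elsewhere w≢p w≢q =
      proper C u w a (trans (sym (swap-col-elsewhere u≢p u≢q)) (trans e (swap-col-elsewhere w≢p w≢q)))

    swap-surj : ∀ i → ∃ λ v → swap-col v ≡ i
    swap-surj i with surj C i
    ... | v , e = τ Perm.⟨$⟩ˡ v , trans (cong (col C) (Perm.inverseʳ τ)) e

    swapped : Coloring G
    swapped = record { k = k C ; col = swap-col ; surj = swap-surj ; proper = swap-proper }

    Frame-swapped : Frame G C ≡ Frame G swapped
    Frame-swapped = cong (Sort.sort ≤-decTotalOrder)
      (map-cong (λ i → count-permute (λ v → col C v ≟ i) τ) (allFin (k C)))

    Avoids : V G → Set
    Avoids u = col C p ≢ col C u × col C q ≢ col C u

    Avoids-resp : ∀ {u w} → col C u ≡ col C w → Avoids w → Avoids u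
    Avoids-resp e (cp≢cw , cq≢cw) = (λ e′ → cp≢cw (trans e′ e)) , (λ e′ → cq≢cw (trans e′ e))

    swap-col-avoiding : ∀ {u} → Avoids u → swap-col u ≡ col C u
    swap-col-avoiding (cp≢cu , cq≢cu) = swap-col-elsewhere (cp≢cu ∘ cong (col C) ∘ sym) (cq≢cu ∘ cong (col C) ∘ sym)

    swapped-class-avoiding : ∀ {w} → Avoids w → ∀ u → (swap-col u ≡ col C w) ⇔ (col C u ≡ col C w)
    swapped-class-avoiding {w} (cp≢cw , cq≢cw) u = mk⇔ forward backward
      where
        forward : swap-col u ≡ col C w → col C u ≡ col C w
        forward e with role u
        ... | is-p refl         = ⊥-elim (cq≢cw (trans (sym swap-col-p) e))
        ... | is-q refl         = ⊥-elim (cp≢cw (trans (sym swap-col-q) e))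
        ... | elsewhere u≢p u≢q = trans (sym (swap-col-elsewhere u≢p u≢q)) e
        backward : col C u ≡ col C w → swap-col u ≡ col C w
        backward e = trans (swap-col-avoiding (Avoids-resp e (cp≢cw , cq≢cw))) e

    map-swap-col-avoiding : ∀ {xs} → All Avoids xs → map swap-col xs ≡ map (col C) xs
    map-swap-col-avoiding = map-cong-All ∘ All.map swap-col-avoiding

    lonely-swapped : ∀ {u w} → u ≡ q ⊎ Avoids u → Avoids w → Lonely G C u w → Lonely G swapped u w
    lonely-swapped {u} {w} u-ok aw (cu≢cw , only-w) = distinct u-ok , λ x → mk⇔
      (λ (a , e) → to (only-w x) (a , to (swapped-class-avoiding aw x) (trans e (swap-col-avoiding aw))))
      (λ { refl → proj₁ (from (only-w w) refl) , refl })
      where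
        distinct : u ≡ q ⊎ Avoids u → swap-col u ≢ swap-col w
        distinct (inj₁ refl) e = proj₁ aw (trans (sym swap-col-q) (trans e (swap-col-avoiding aw)))
        distinct (inj₂ au)   e = cu≢cw (trans (sym (swap-col-avoiding au)) (trans e (swap-col-avoiding aw)))

    linked-lonely-swapped : ∀ {x xs} → x ≡ q ⊎ Avoids x → All Avoids xs →
      Linked (Lonely G C) (x ∷ xs) → Linked (Lonely G swapped) (x ∷ xs)
    linked-lonely-swapped {xs = []}    _    _          _        = [-]
    linked-lonely-swapped {xs = _ ∷ _} x-ok (ay ∷ ays) (l ∷ ls) =
      lonely-swapped x-ok ay l ∷ linked-lonely-swapped (inj₂ ay) ays ls

    q-singleton-swapped : IsSingletonClass G swapped (swap-col q) q
    q-singleton-swapped u = mk⇔ forward (λ { refl → refl })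
      where
        forward : swap-col u ≡ swap-col q → u ≡ q
        forward e with role u
        ... | is-p refl         = ⊥-elim (cp≢cq (trans (sym swap-col-q) (trans (sym e) swap-col-p)))
        ... | is-q refl         = refl
        ... | elsewhere u≢p u≢q = ⊥-elim (swap-col-q≢elsewhere u≢p u≢q (sym e))

    singleton-swapped : ∀ {w} → Avoids w → IsSingletonClass G C (col C w) w → IsSingletonClass G swapped (swap-col w) w
    singleton-swapped aw w-singleton u = mk⇔
      (λ e → to (w-singleton u) (to (swapped-class-avoiding aw u) (trans e (swap-col-avoiding aw))))
      (λ { refl → refl })

module _ (G : Graph) (P : Property G) where
  open Graph G using (Adj; dec) renaming (sym to Adj-sym)

  record OptimalPathPair (C : Coloring G) (a b : V G) (pa pb : List (V G)) : Set where
    field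
      optimal     : IsOptimal G P C
      ca≢cb         : col C a ≢ col C b
      a-singleton : IsSingletonClass G C (col C a) a
      b-singleton : IsSingletonClass G C (col C b) b
      path-a      : IsDirPath G C (a ∷ pa)
      path-b      : IsDirPath G C (b ∷ pb)
      disjoint    : ∀ x → x ∈ a ∷ pa → x ∈ b ∷ pb → ⊥
      rainbow-a   : Unique (map (col C) (a ∷ pa))
      rainbow-b   : Unique (map (col C) (b ∷ pb))

  OptimalPathPair-sym : ∀ {C a b pa pb} → OptimalPathPair C a b pa pb → OptimalPathPair C b a pb pa
  OptimalPathPair-sym pp = record
    { optimal = optimal ; ca≢cb = ≢-sym ca≢cb ; a-singleton = b-singleton ; b-singleton = a-singleton
    ; path-a = path-b ; path-b = path-a ; disjoint = λ x x∈b x∈a → disjoint x x∈a x∈b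
    ; rainbow-a = rainbow-b ; rainbow-b = rainbow-a
    }
    where open OptimalPathPair pp

  OptimalPathPair-prefix : ∀ {C a b} pa₁ pa₂ pb₁ pb₂ →
    OptimalPathPair C a b (pa₁ ++ pa₂) (pb₁ ++ pb₂) → OptimalPathPair C a b pa₁ pb₁
  OptimalPathPair-prefix {C} {a} {b} pa₁ pa₂ pb₁ pb₂ pp = record
    { optimal = optimal ; ca≢cb = ca≢cb ; a-singleton = a-singleton ; b-singleton = b-singleton
    ; path-a = Linked-++⁻ˡ (a ∷ pa₁) (proj₁ path-a) , Unique-++⁻ˡ (a ∷ pa₁) (proj₂ path-a)
    ; path-b = Linked-++⁻ˡ (b ∷ pb₁) (proj₁ path-b) , Unique-++⁻ˡ (b ∷ pb₁) (proj₂ path-b)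
    ; disjoint = λ x x∈a x∈b → disjoint x (∈-++⁺ˡ x∈a) (∈-++⁺ˡ x∈b)
    ; rainbow-a = Unique-++⁻ˡ (map (col C) (a ∷ pa₁)) (subst Unique (map-++ (col C) (a ∷ pa₁) pa₂) rainbow-a)
    ; rainbow-b = Unique-++⁻ˡ (map (col C) (b ∷ pb₁)) (subst Unique (map-++ (col C) (b ∷ pb₁) pb₂) rainbow-b)
    }
    where open OptimalPathPair pp

  first-lonely : ∀ {C a b v rest pb} → OptimalPathPair C a b (v ∷ rest) pb → Lonely G C a v
  first-lonely pp with proj₁ (OptimalPathPair.path-a pp)
  ... | l ∷ _ = l

  module _ (singleton-friendly : IsSingletonFriendly G P) (frame-property : IsFrameProperty G P) where

    optimal-singletons-adjacent : ∀ {C a b} → IsOptimal G P C → col C a ≢ col C b →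
      IsSingletonClass G C (col C a) a → IsSingletonClass G C (col C b) b → Adj a b
    optimal-singletons-adjacent {C} {a} {b} (C∈P , minimal) ca≢cb a-singleton b-singleton with dec a b
    ... | yes a~b = a~b
    ... | no ¬a~b with mergeSingletons G C ca≢cb a-singleton b-singleton ¬a~b
    ...   | C′ , fewer , merge = ⊥-elim (1+n≰n (subst (_≤ k C′) (sym fewer) (minimal C′ C′∈P)))
      where
        C′∈P : P C′
        C′∈P = singleton-friendly C (col C a) (col C b) a b ca≢cb a-singleton b-singleton C′ merge C∈P

    swap-first : ∀ {C a b v rest pb} (pp : OptimalPathPair C a b (v ∷ rest) pb) →
      (∀ w → w ∈ pb → col C w ≢ col C v) →
      OptimalPathPair (Swap.swapped G C (OptimalPathPair.a-singleton pp) (first-lonely pp)) v b rest pb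
    swap-first {C} {a} {b} {v} {rest} {pb} pp pb-avoids-cv = record
      { optimal     = frame-property C swapped Frame-swapped (proj₁ optimal) , proj₂ optimal
      ; ca≢cb       = λ e → ca≢cb (trans (sym swap-col-q) (trans e (swap-col-avoiding b-avoids)))
      ; a-singleton = q-singleton-swapped
      ; b-singleton = singleton-swapped b-avoids b-singleton
      ; path-a      = linked-lonely-swapped (inj₁ refl) rest-avoids (Linked.tail (proj₁ path-a)) , Unique.tail (proj₂ path-a)
      ; path-b      = linked-lonely-swapped (inj₂ b-avoids) pb-avoids (proj₁ path-b) , proj₂ path-b
      ; disjoint    = λ x x∈v x∈b → disjoint x (there x∈v) x∈b
      ; rainbow-a   = subst Unique (sym (cong₂ _∷_ swap-col-q (map-swap-col-avoiding rest-avoids))) rainbow-a-swapped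
      ; rainbow-b   = subst Unique (sym (map-swap-col-avoiding (b-avoids ∷ pb-avoids))) rainbow-b
      }
      where
        open OptimalPathPair pp
        open Swap G C a-singleton (first-lonely pp)

        rest-avoids : All Avoids rest
        rest-avoids with rainbow-a
        ... | (_ ∷ ca∉crest) ∷ (cv∉crest ∷ _) = All.zip (All.map⁻ ca∉crest , All.map⁻ cv∉crest)

        rainbow-a-swapped : Unique (col C a ∷ map (col C) rest)
        rainbow-a-swapped with rainbow-a
        ... | (_ ∷ ca∉crest) ∷ (_ ∷ rainbow-rest) = ca∉crest ∷ rainbow-rest

        a∉b-path : ∀ {x} → x ∈ b ∷ pb → x ≢ a
        a∉b-path x∈ refl = disjoint _ (here refl) x∈

        v∉b-path : ∀ {x} → x ∈ b ∷ pb → x ≢ v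
        v∉b-path x∈ refl = disjoint _ (there (here refl)) x∈

        b-avoids : Avoids b
        b-avoids = ca≢cb , λ e → v∉b-path (here refl) (sym (to (b-singleton v) e))

        pb-avoids : All Avoids pb
        pb-avoids = All.tabulate λ {w} w∈ →
          (λ e → a∉b-path (there w∈) (to (a-singleton w) (sym e))) , ≢-sym (pb-avoids-cv w w∈)

    AdjacentEnds : ℕ → Set
    AdjacentEnds m = ∀ {C a b pa pb} → length pa + length pb ≤ m →
      OptimalPathPair C a b pa pb → Adj (last a pa) (last b pb)

    -- If w had v's color, its predecessor u on b's path, adjacent to v by the shorter instance
    -- formed by the paths a v and b … u, would have both v and w as neighbours in w's class.
    pb-avoids-color-of-next : ∀ {m C a b v rest pb} → AdjacentEnds m → length pb ≤ m →
      OptimalPathPair C a b (v ∷ rest) pb → ∀ w → w ∈ pb → col C w ≢ col C v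
    pb-avoids-color-of-next {C = C} {a} {b} {v} {rest} ih pb≤m pp w w∈ with ∈-∃++ w∈
    ... | pre , suf , refl = λ cw≡cv → disjoint v (there (here refl)) (there (∈-++⁺ʳ pre (here (v≡w cw≡cv))))
      where
        open OptimalPathPair pp

        pre<pb : suc (length pre) ≤ length (pre ++ w ∷ suf)
        pre<pb = subst (suc (length pre) ≤_) (sym (length-++ pre)) (m<m+n (length pre) (s≤s z≤n))

        v~pre : Adj v (last b pre)
        v~pre = ih (≤-trans pre<pb pb≤m) (OptimalPathPair-prefix (v ∷ []) rest pre (w ∷ suf) pp)

        v≡w : col C w ≡ col C v → v ≡ w
        v≡w cw≡cv = to (proj₂ (Linked-last b pre (proj₁ path-b)) v) (Adj-sym v~pre , sym cw≡cv)

    adjacentEnds-step : ∀ {m C a b v rest pb} → AdjacentEnds m → length rest + length pb ≤ m →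
      OptimalPathPair C a b (v ∷ rest) pb → Adj (last v rest) (last b pb)
    adjacentEnds-step {rest = rest} {pb} ih le pp =
      ih le (swap-first pp (pb-avoids-color-of-next ih (≤-trans (m≤n+m (length pb) (length rest)) le) pp))

    adjacentEnds : ∀ m → AdjacentEnds m
    adjacentEnds m {pa = []} {[]} _ pp =
      optimal-singletons-adjacent optimal ca≢cb a-singleton b-singleton
      where open OptimalPathPair pp
    adjacentEnds (suc m) {pa = _ ∷ _} (s≤s le) pp =
      adjacentEnds-step (adjacentEnds m) le pp
    adjacentEnds (suc m) {pa = []} {_ ∷ rest} (s≤s le) pp =
      Adj-sym (adjacentEnds-step (adjacentEnds m) (subst (_≤ m) (sym (+-identityʳ (length rest))) le)
                                 (OptimalPathPair-sym pp))

mainTheorem11 : (G : Graph) (P : Property G) →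
    IsSingletonFriendly G P → IsFrameProperty G P →
    (C : Coloring G) → IsOptimal G P C →
    (a b : V G) → col C a ≢ col C b →
    IsSingletonClass G C (col C a) a → IsSingletonClass G C (col C b) b →
    (pa pb : List (V G)) →
    IsDirPath G C (a ∷ pa) → IsDirPath G C (b ∷ pb) →
    (∀ x → x ∈ a ∷ pa → x ∈ b ∷ pb → ⊥) →
    Unique (map (col C) (a ∷ pa)) → Unique (map (col C) (b ∷ pb)) →
    ∀ x y → x ∈ a ∷ pa → y ∈ b ∷ pb → Graph.Adj G x y
mainTheorem11 G P singleton-friendly frame-property C optimal a b ca≢cb a-singleton b-singleton
              pa pb path-a path-b disjoint rainbow-a rainbow-b x y x∈ y∈
  with ∈⇒prefix-ending-at pa x∈ | ∈⇒prefix-ending-at pb y∈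
... | pa₁ , pa₂ , refl , refl | pb₁ , pb₂ , refl , refl =
  adjacentEnds G P singleton-friendly frame-property _ ≤-refl (OptimalPathPair-prefix G P pa₁ pa₂ pb₁ pb₂ pp)
  where
    pp : OptimalPathPair G P C a b (pa₁ ++ pa₂) (pb₁ ++ pb₂)
    pp = record
      { optimal = optimal ; ca≢cb = ca≢cb ; a-singleton = a-singleton ; b-singleton = b-singleton
      ; path-a = path-a ; path-b = path-b ; disjoint = disjoint ; rainbow-a = rainbow-a ; rainbow-b = rainbow-b }
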